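{- Let $n\ge 2$, let $\mathbf A$ be a Boolean-like algebra of dimension $n$, and let $a,b^1,\dots,b^n\in A$. Then: (i) the coordinates $a_1,\dots,a_n$ of $a$ satisfy $\bigvee_{i=1}^n a_i=1$ and $a_i\wedge a_k=0$ for all $i\ne k$; (ii) for every $1\le i\le n$, $q(a,b^1,\dots,b^n)_i=q(a,(b^1)_i,\dots,(b^n)_i)=\bigvee_{j=1}^n a_j\wedge(b^j)_i$, where $(b^j)_i$ is the $i$-th coordinate of $b^j$. Here $\vee,\wedge,0,1$ are computed in the Boolean algebra $B_{\mathbf A}$.
   Context: An algebra $\mathbf A$ is an algebra of dimension $n$ with respect to an $(n+1)$-ary term operation $q$ and constants $\mathsf e_1,\dots,\mathsf e_n$ if $q(\mathsf e_i,b_1,\dots,b_n)=b_i$ for all $b_j\in A$. $\theta(a,b)$ is the smallest congruence containing $(a,b)$; $c$ is $n$-central if $x\mapsto(x/\theta(c,\mathsf e_1),\dots,x/\theta(c,\mathsf e_n))$ is an isomorphism from $\mathbf A$ onto $\prod_i\mathbf A/\theta(c,\mathsf e_i)$; a Boolean-like algebra of dimension $n$ is one in which all elements are $n$-central. Define $p(x,y,z)=q(x,y,z,\mathsf e_3,\dots,\mathsf e_n)$ (for $n=2$, $p=q$) and $B_{\mathbf A}=\{x\in A: p(x,y,y)=y\text{ for all }y\in A\}$; $B_{\mathbf A}$ is a Boolean algebra with $x\wedge y=p(x,\mathsf e_1,y)$, $x\vee y=p(x,y,\mathsf e_2)$, $\neg x=p(x,\mathsf e_2,\mathsf e_1)$,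 $0=\mathsf e_1$, $1=\mathsf e_2$. For a permutation $\sigma$ of $\{1,\dots,n\}$ write $x^\sigma=q(x,\mathsf e_{\sigma1},\dots,\mathsf e_{\sigma n})$; let $(2i)$ denote the transposition of $2$ and $i$ (the identity if $i=2$). The $i$-th coordinate of $a\in A$ is $a_i=q(a^{(2i)},\mathsf e_1,\mathsf e_2,\mathsf e_1,\dots,\mathsf e_1)$ (with $\mathsf e_1$ in all of the last $n-2$ positions); $a_i\in B_{\mathbf A}$. -}

module Defs where

open import Data.Nat using (ℕ; zero; suc)
open import Data.Fin using (Fin; zero; suc)
open import Data.Empty using (⊥; ⊥-elim)
open import Data.Product using (∃; _×_)
open import Data.Vec.Functional using (_∷_)
open import Data.Fin.Permutation.Components using (transpose)
open import Relation.Binary.PropositionalEquality using (_≡_)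

record Signature : Set₁ where
  field
    Op    : Set
    arity : Op → ℕ
open Signature public

-- An algebra of the given signature (carrier with propositional equality).
record Algebra (S : Signature) : Set₁ where
  field
    Carrier : Set
    ⟦_⟧     : (f : Op S) → (Fin (arity S f) → Carrier) → Carrier
open Algebra public

data Term (S : Signature) (V : Set) : Set where
  var : V → Term S V
  op  : (f : Op S) → (Fin (arity S f) → Term S V) → Term S V

module _ {S : Signature} (A : Algebra S) where

  eval : {V : Set} → (V → Carrier A) → Term S V → Carrier A
  eval ρ (var v)   = ρ v
  eval ρ (op f ts) = ⟦ A ⟧ f (λ i → eval ρ (ts i))

  -- θ(c,d): the smallest congruence containing (c,d), generated inductively.
  data Cg (c d : Carrier A) : Carrier A → Carrier A → Set where
    base   : Cg c d c d
    refl   : ∀ {x} → Cg c d x x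
    sym    : ∀ {x y} → Cg c d x y → Cg c d y x
    trans  : ∀ {x y z} → Cg c d x y → Cg c d y z → Cg c d x z
    compat : ∀ (f : Op S) {xs ys : Fin (arity S f) → Carrier A} →
             (∀ i → Cg c d (xs i) (ys i)) → Cg c d (⟦ A ⟧ f xs) (⟦ A ⟧ f ys)

  module Dim (n : ℕ) (qt : Term S (Fin (suc n))) (et : Fin n → Term S ⊥) where

    q : Carrier A → (Fin n → Carrier A) → Carrier A
    q x bs = eval (x ∷ bs) qt

    e : Fin n → Carrier A
    e i = eval ⊥-elim (et i)

    IsDimension : Set
    IsDimension = ∀ (i : Fin n) (bs : Fin n → Carrier A) → q (e i) bs ≡ bs i

    -- c is n-central: x ↦ (x/θ(c,e_1),…,x/θ(c,e_n)) is a bijection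
    -- A → ∏ A/θ(c,e_i) (it is automatically a homomorphism).
    IsCentral : Carrier A → Set
    IsCentral c =
      (∀ x y → (∀ i → Cg c (e i) x y) → x ≡ y) ×
      (∀ (ys : Fin n → Carrier A) → ∃ λ x → ∀ i → Cg c (e i) x (ys i))

    IsBooleanLike : Set
    IsBooleanLike = IsDimension × (∀ c → IsCentral c)

  -- Specialisation to n = m + 2 (indices 0,1,2,… stand for 1,2,3,…).
  module Dim2 (m : ℕ) (qt : Term S (Fin (suc (suc (suc m))))) (et : Fin (suc (suc m)) → Term S ⊥) where
    open Dim (suc (suc m)) qt et public

    p : Carrier A → Carrier A → Carrier A → Carrier A
    p x y z = q x args
      where
        args : Fin (suc (suc m)) → Carrier A
        args zero          = y
        args (suc zero)    = z
        args (suc (suc k)) = e (suc (suc k))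

    _∧_ : Carrier A → Carrier A → Carrier A
    x ∧ y = p x (e zero) y

    _∨_ : Carrier A → Carrier A → Carrier A
    x ∨ y = p x y (e (suc zero))

    ¬_ : Carrier A → Carrier A
    ¬ x = p x (e (suc zero)) (e zero)

    𝟘 𝟙 : Carrier A
    𝟘 = e zero
    𝟙 = e (suc zero)

    _^_ : Carrier A → (Fin (suc (suc m)) → Fin (suc (suc m))) → Carrier A
    x ^ σ = q x (λ j → e (σ j))

    coord : Carrier A → Fin (suc (suc m)) → Carrier A
    coord a i = q (a ^ transpose (suc zero) i) args
      where
        args : Fin (suc (suc m)) → Carrier A
        args zero          = e zero
        args (suc zero)    = e (suc zero)
        args (suc (suc k)) = e zero

    ⋁ : ∀ {k} → (Fin (suc k) → Carrier A) → Carrier A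
    ⋁ {zero}  f = f zero
    ⋁ {suc k} f = f zero ∨ ⋁ (λ j → f (suc j))

module Submission where

-- In a Boolean-like algebra every element a is n-central, so
-- two elements x, y coincide as soon as x ≡ y modulo θ(a,eᵢ) for every i;
-- and modulo θ(a,eᵢ) the element a behaves like the constant eᵢ.  Since
-- every function built from term operations is compatible with every
-- principal congruence, an identity F a ≡ G a between such functions holds
-- for all a once it holds for a = e₁,…,eₙ (`agree-on-constants`).  Each
-- claim of the theorem is an identity of this form, and at a constant it is
-- a direct computation: q(eᵢ,b) = bᵢ, and the coordinates of eᵢ form the
-- i-th row of the identity matrix (coordinate k is 𝟙 if i = k and 𝟘 else).

open import Defs
open import Data.Nat using (ℕ; suc)
open import Data.Fin using (Fin; zero; suc)
open import Data.Fin.Patterns using (0F; 1F)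
open import Data.Fin.Properties using (_≟_; suc-injective)
open import Data.Fin.Permutation.Components using (transpose; transpose-inverse)
open import Data.Empty using (⊥; ⊥-elim)
open import Function using (_∘_)
open import Data.Product using (_×_; _,_; proj₁; proj₂)
open import Relation.Nullary using (yes; no)
open import Relation.Nullary.Decidable using (dec-true)
-- sym, trans and refl unqualified are the constructors of the congruence Cg.
open import Relation.Binary.PropositionalEquality
  using (_≡_; _≢_; ≢-sym; refl; cong; cong₂; module ≡-Reasoning)
  renaming (sym to ≡-sym; trans to ≡-trans)

transpose-right : ∀ {n} (i j : Fin n) → transpose i j j ≡ i
transpose-right i j with j ≟ i
... | yes j≡i = j≡i
... | no  _   rewrite dec-true (j ≟ j) refl = refl

transpose-hits-left : ∀ {n} (i j k : Fin n) → transpose i j k ≡ i → k ≡ j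
transpose-hits-left i j k eq = begin
  k                             ≡⟨ ≡-sym (transpose-inverse j i) ⟩
  transpose j i (transpose i j k) ≡⟨ cong (transpose j i) eq ⟩
  transpose j i i               ≡⟨ transpose-right j i ⟩
  j                             ∎
  where open ≡-Reasoning

module _ {S : Signature} (A : Algebra S) where

  ≡⇒Cg : ∀ {c d x y} → x ≡ y → Cg A c d x y
  ≡⇒Cg refl = refl

  eval-compatible : ∀ {c d} {V : Set} {ρ ρ′ : V → Carrier A} →
    (∀ v → Cg A c d (ρ v) (ρ′ v)) → ∀ t → Cg A c d (eval A ρ t) (eval A ρ′ t)
  eval-compatible ρ≈ρ′ (var v)   = ρ≈ρ′ v
  eval-compatible ρ≈ρ′ (op f ts) = compat f (λ i → eval-compatible ρ≈ρ′ (ts i))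

module BooleanLike {S : Signature} (A : Algebra S) (m : ℕ)
    (qt : Term S (Fin (suc (suc (suc m))))) (et : Fin (suc (suc m)) → Term S ⊥)
    (boolean-like : Dim2.IsBooleanLike A m qt et) where

  open Dim2 A m qt et

  private
    N = Fin (suc (suc m))
    C = Carrier A

  dimension : IsDimension
  dimension = proj₁ boolean-like

  central : ∀ c → IsCentral c
  central = proj₂ boolean-like

  q-compatible : ∀ {c d x x′} {bs bs′ : N → C} → Cg A c d x x′ →
    (∀ j → Cg A c d (bs j) (bs′ j)) → Cg A c d (q x bs) (q x′ bs′)
  q-compatible x≈x′ bs≈bs′ = eval-compatible A (λ { zero → x≈x′ ; (suc j) → bs≈bs′ j }) qt

  p-compatible : ∀ {c d x x′ y y′ z z′} → Cg A c d x x′ → Cg A c d y y′ →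
    Cg A c d z z′ → Cg A c d (p x y z) (p x′ y′ z′)
  p-compatible x≈ y≈ z≈ = q-compatible x≈ (λ { 0F → y≈ ; 1F → z≈ ; (suc (suc _)) → refl })

  ∧-compatibleˡ : ∀ {c d x x′} y → Cg A c d x x′ → Cg A c d (x ∧ y) (x′ ∧ y)
  ∧-compatibleˡ y x≈x′ = p-compatible x≈x′ refl refl

  coord-compatible : ∀ {c d x x′} k → Cg A c d x x′ → Cg A c d (coord x k) (coord x′ k)
  coord-compatible k x≈x′ = q-compatible (q-compatible x≈x′ (λ _ → refl)) (λ _ → refl)

  ⋁-compatible : ∀ {c d k} {f g : Fin (suc k) → C} →
    (∀ j → Cg A c d (f j) (g j)) → Cg A c d (⋁ f) (⋁ g)
  ⋁-compatible {k = ℕ.zero} f≈g = f≈g zero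
  ⋁-compatible {k = suc k}  f≈g = p-compatible (f≈g zero) (⋁-compatible (λ j → f≈g (suc j))) refl

  Compatible : (C → C) → Set
  Compatible F = ∀ {c d x y} → Cg A c d x y → Cg A c d (F x) (F y)

  -- The reduction principle: compatible functions agreeing on the constants
  -- e₁,…,eₙ agree everywhere, by the n-centrality of the argument.
  agree-on-constants : ∀ (F G : C → C) → Compatible F → Compatible G →
    (∀ i → F (e i) ≡ G (e i)) → ∀ a → F a ≡ G a
  agree-on-constants F G F-compat G-compat agree a = proj₁ (central a) _ _ λ i →
    trans (F-compat base) (trans (≡⇒Cg A (agree i)) (sym (G-compat base)))

  p-𝟘 : ∀ y z → p 𝟘 y z ≡ y
  p-𝟘 y z = dimension 0F _

  p-𝟙 : ∀ y z → p 𝟙 y z ≡ z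
  p-𝟙 y z = dimension 1F _

  ∧-zeroˡ : ∀ y → 𝟘 ∧ y ≡ 𝟘
  ∧-zeroˡ y = p-𝟘 𝟘 y

  ∧-identityˡ : ∀ y → 𝟙 ∧ y ≡ y
  ∧-identityˡ y = p-𝟙 𝟘 y

  ∨-identityˡ : ∀ y → 𝟘 ∨ y ≡ y
  ∨-identityˡ y = p-𝟘 y 𝟙

  -- Coordinates of the constants: coord (eᵢ) k = 𝟙 if i = k and 𝟘 otherwise.
  -- Since q(eᵢ ^ σ, h) = h(σ i), this is read off from the vector
  -- h = (e₁,e₂,e₁,…,e₁) used in the definition of coord.

  q-permuted-constant : ∀ i σ (h : N → C) → q (e i ^ σ) h ≡ h (σ i)
  q-permuted-constant i σ h = ≡-trans (cong (λ z → q z h) (dimension i _)) (dimension (σ i) h)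

  permuted-constant-diag : (h : N → C) → h 1F ≡ 𝟙 → ∀ k → q (e k ^ transpose 1F k) h ≡ 𝟙
  permuted-constant-diag h h₂≡𝟙 k =
    ≡-trans (q-permuted-constant k _ h) (≡-trans (cong h (transpose-right 1F k)) h₂≡𝟙)

  permuted-constant-off : (h : N → C) → (∀ j → j ≢ 1F → h j ≡ 𝟘) →
    ∀ i k → i ≢ k → q (e i ^ transpose 1F k) h ≡ 𝟘
  permuted-constant-off h h-off i k i≢k = ≡-trans (q-permuted-constant i _ h)
    (h-off _ (λ hits → i≢k (transpose-hits-left 1F k i hits)))

  coord-e-diag : ∀ k → coord (e k) k ≡ 𝟙
  coord-e-diag k = permuted-constant-diag _ refl k

  coord-e-off : ∀ i k → i ≢ k → coord (e i) k ≡ 𝟘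
  coord-e-off i k = permuted-constant-off _
    (λ { 0F _ → refl ; 1F 1≢1 → ⊥-elim (1≢1 refl) ; (suc (suc _)) _ → refl }) i k

  -- Coordinates are fixed by ∨ 𝟘, like every element of B_A; this is the
  -- only Boolean property of coordinates the joins below require.
  coord-∨-𝟘 : ∀ x k → coord x k ∨ 𝟘 ≡ coord x k
  coord-∨-𝟘 x k = agree-on-constants (λ y → coord y k ∨ 𝟘) (λ y → coord y k)
    (λ y≈ → p-compatible (coord-compatible k y≈) refl refl) (coord-compatible k) at-constant x
    where
      open ≡-Reasoning
      at-constant : ∀ i → coord (e i) k ∨ 𝟘 ≡ coord (e i) k
      at-constant i with i ≟ k
      ... | yes refl = begin
        coord (e i) i ∨ 𝟘 ≡⟨ cong (_∨ 𝟘) (coord-e-diag i) ⟩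
        𝟙 ∨ 𝟘             ≡⟨ p-𝟙 𝟘 𝟙 ⟩
        𝟙                 ≡⟨ ≡-sym (coord-e-diag i) ⟩
        coord (e i) i     ∎
      ... | no i≢k = begin
        coord (e i) k ∨ 𝟘 ≡⟨ cong (_∨ 𝟘) (coord-e-off i k i≢k) ⟩
        𝟘 ∨ 𝟘             ≡⟨ ∨-identityˡ 𝟘 ⟩
        𝟘                 ≡⟨ ≡-sym (coord-e-off i k i≢k) ⟩
        coord (e i) k     ∎

  ⋁-𝟘 : ∀ {k} (f : Fin (suc k) → C) → (∀ j → f j ≡ 𝟘) → ⋁ f ≡ 𝟘
  ⋁-𝟘 {ℕ.zero} f f≡𝟘 = f≡𝟘 zero
  ⋁-𝟘 {suc k}  f f≡𝟘 = ≡-trans (cong₂ _∨_ (f≡𝟘 zero) (⋁-𝟘 (λ j → f (suc j)) (λ j → f≡𝟘 (suc j))))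
                                (∨-identityˡ 𝟘)

  ⋁-single : ∀ {k} (f : Fin (suc k) → C) i {y} → y ∨ 𝟘 ≡ y →
    f i ≡ y → (∀ j → j ≢ i → f j ≡ 𝟘) → ⋁ f ≡ y
  ⋁-single {ℕ.zero} f zero    y∨𝟘 fi≡y others = fi≡y
  ⋁-single {suc k}  f zero    y∨𝟘 fi≡y others =
    ≡-trans (cong₂ _∨_ fi≡y (⋁-𝟘 (λ j → f (suc j)) (λ j → others (suc j) λ ()))) y∨𝟘
  ⋁-single {suc k}  f (suc i) y∨𝟘 fi≡y others =
    ≡-trans (cong (_∨ ⋁ (λ j → f (suc j))) (others zero λ ()))
      (≡-trans (∨-identityˡ _)
        (⋁-single (λ j → f (suc j)) i y∨𝟘 fi≡y (λ j j≢i → others (suc j) (j≢i ∘ suc-injective))))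

  coords-join : ∀ a → ⋁ (λ i → coord a i) ≡ 𝟙
  coords-join = agree-on-constants (λ x → ⋁ (λ i → coord x i)) (λ _ → 𝟙)
    (λ x≈ → ⋁-compatible (λ j → coord-compatible j x≈)) (λ _ → refl)
    λ i → ⋁-single _ i (p-𝟙 𝟘 𝟙) (coord-e-diag i) (λ j j≢i → coord-e-off i j (≢-sym j≢i))

  coords-disjoint : ∀ a i k → i ≢ k → coord a i ∧ coord a k ≡ 𝟘
  coords-disjoint a i k i≢k = agree-on-constants (λ x → coord x i ∧ coord x k) (λ _ → 𝟘)
    (λ x≈ → p-compatible (coord-compatible i x≈) refl (coord-compatible k x≈)) (λ _ → refl)
    at-constant a
    where
      at-constant : ∀ l → coord (e l) i ∧ coord (e l) k ≡ 𝟘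
      at-constant l with l ≟ i
      ... | yes refl = ≡-trans (cong₂ _∧_ (coord-e-diag l) (coord-e-off l k i≢k)) (∧-identityˡ 𝟘)
      ... | no l≢i   = ≡-trans (cong (_∧ coord (e l) k) (coord-e-off l i l≢i)) (∧-zeroˡ _)

  coord-of-q : ∀ a (b : N → C) k → coord (q a b) k ≡ q a (λ j → coord (b j) k)
  coord-of-q a b k = agree-on-constants (λ x → coord (q x b) k) (λ x → q x (λ j → coord (b j) k))
    (λ x≈ → coord-compatible k (q-compatible x≈ (λ _ → refl))) (λ x≈ → q-compatible x≈ (λ _ → refl))
    (λ i → ≡-trans (cong (λ z → coord z k) (dimension i b)) (≡-sym (dimension i _))) a

  q-as-join : ∀ a (b : N → C) k → q a (λ j → coord (b j) k) ≡ ⋁ (λ j → coord a j ∧ coord (b j) k)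
  q-as-join a b k = agree-on-constants
    (λ x → q x (λ j → coord (b j) k)) (λ x → ⋁ (λ j → coord x j ∧ coord (b j) k))
    (λ x≈ → q-compatible x≈ (λ _ → refl))
    (λ x≈ → ⋁-compatible (λ j → ∧-compatibleˡ (coord (b j) k) (coord-compatible j x≈))) at-constant a
    where
      at-constant : ∀ i → q (e i) (λ j → coord (b j) k) ≡ ⋁ (λ j → coord (e i) j ∧ coord (b j) k)
      at-constant i = ≡-trans (dimension i _) (≡-sym (⋁-single _ i (coord-∨-𝟘 (b i) k)
        (≡-trans (cong (_∧ coord (b i) k) (coord-e-diag i)) (∧-identityˡ _))
        (λ j j≢i → ≡-trans (cong (_∧ coord (b j) k) (coord-e-off i j (≢-sym j≢i))) (∧-zeroˡ _))))

lemma6p8 : {S : Signature} (A : Algebra S) (m : ℕ)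
    (qt : Term S (Fin (suc (suc (suc m))))) (et : Fin (suc (suc m)) → Term S ⊥) →
    let open Dim2 A m qt et in
    IsBooleanLike →
    (a : Carrier A) (b : Fin (suc (suc m)) → Carrier A) →
    ((⋁ (λ i → coord a i) ≡ 𝟙)
      × (∀ (i k : Fin (suc (suc m))) → i ≢ k → (coord a i ∧ coord a k) ≡ 𝟘))
    × (∀ (i : Fin (suc (suc m))) →
        (coord (q a b) i ≡ q a (λ j → coord (b j) i))
        × (q a (λ j → coord (b j) i) ≡ ⋁ (λ j → coord a j ∧ coord (b j) i)))
lemma6p8 A m qt et boolean-like a b =
  (coords-join a , coords-disjoint a) , (λ i → coord-of-q a b i , q-as-join a b i)
  where open BooleanLike A m qt et boolean-like
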